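{- Let $p$ be a prime, let $K$ be a field of characteristic $p$, and let $K^{p^{ -\infty}}$ denote its perfect closure. Let $r$ be a positive integer and let $g\in K^{p^{ -\infty}}$ be such that $g^{p}\in K$. Define $g_1=g$ and $g_i=g^{p^{1-i}}g_{i-1}^{p^{r}}$ for $i>1$ (elements of $K^{p^{ -\infty}}$). Then for every integer $d\geq 0$, \[ S_{d}\big((g_{d}u^{p^{dr}},\dots,g_{1}u^{p^{r}},u);(g_{d}v^{p^{dr}},\dots,g_{1}v^{p^{r}},v)\big)\in K[u,v], \] where $u,v$ are indeterminates and the left side is a priori an element of $K^{p^{ -\infty}}[u,v]$.
   Context: The Witt polynomials are $w_d(Z_0,\dots,Z_d)=Z_0^{p^d}+pZ_1^{p^{d-1}}+\cdots+p^dZ_d\in\mathbb{Z}[Z_0,\dots,Z_d]$. The Witt addition polynomials $S_d=S_d((X_0,\dots,X_d);(Y_0,\dots,Y_d))$ are defined recursively by $w_d(S_0,\dots,S_d)=w_d(X_0,\dots,X_d)+w_d(Y_0,\dots,Y_d)$; they have integer coefficients, so they may be evaluated in any commutative ring, in particular in rings of characteristic $p$. For example $S_0=X_0+Y_0$ and $S_1=X_1+Y_1-\sum_{i=1}^{p-1}\frac{(p-1)!}{i!(p-i)!}X_0^iY_0^{p-i}$. Since $K^{p^{ -\infty}}$ is perfect, $p$-power roots in it are unique, so the $g_i$ are well defined. -}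

module Defs where

open import Level using (Level; _⊔_) renaming (suc to lsuc)
open import Data.Nat as ℕ using (ℕ; zero; suc)
open import Data.Nat.Properties as ℕP using ()
open import Data.Integer as ℤ using (ℤ; +_; -[1+_])
open import Data.Integer.DivMod using (_/ℕ_)
open import Data.Fin using (Fin; toℕ)
open import Data.Vec as Vec using (Vec; []; _∷_)
open import Data.Vec.Properties using (≡-dec)
open import Data.List as List using (List; []; _∷_; _++_)
open import Data.Product using (Σ; _×_; _,_; proj₁; proj₂)
open import Relation.Nullary using (¬_; yes; no)
open import Relation.Nullary.Decidable using (_×-dec_)
open import Relation.Binary.PropositionalEquality using (_≡_)
open import Algebra.Bundles using (CommutativeRing)
open import Data.Nat.Primality using (Prime)

-- Integer polynomials in the variables X_0..X_{N-1}, Y_0..Y_{N-1}.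
-- A polynomial is a finite formal sum of terms  c · X^a Y^b  (list of
-- terms; a list denotes the sum of its terms).

Mon : ℕ → Set
Mon N = Vec ℕ N × Vec ℕ N

ZPoly : ℕ → Set
ZPoly N = List (ℤ × Mon N)

module _ {N : ℕ} where

  monMul : Mon N → Mon N → Mon N
  monMul (a , b) (a' , b') = Vec.zipWith ℕ._+_ a a' , Vec.zipWith ℕ._+_ b b'

  mon1 : Mon N
  mon1 = Vec.replicate N 0 , Vec.replicate N 0

  pzero : ZPoly N
  pzero = []

  pconst : ℤ → ZPoly N
  pconst c = (c , mon1) ∷ []

  padd : ZPoly N → ZPoly N → ZPoly N
  padd = _++_

  pscale : ℤ → ZPoly N → ZPoly N
  pscale c = List.map (λ { (d , m) → (c ℤ.* d , m) })

  pneg : ZPoly N → ZPoly N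
  pneg = pscale (ℤ.- (+ 1))

  pmul : ZPoly N → ZPoly N → ZPoly N
  pmul P Q = List.concatMap (λ { (c , m) → List.map (λ { (d , m') → (c ℤ.* d , monMul m m') }) Q }) P

  ppow : ZPoly N → ℕ → ZPoly N
  ppow P zero    = pconst (+ 1)
  ppow P (suc n) = pmul P (ppow P n)

  -- collecting like terms (a canonical-enough form in which coefficients
  -- of distinct monomials are separated)
  insertTerm : ℤ × Mon N → ZPoly N → ZPoly N
  insertTerm t [] = t ∷ []
  insertTerm (c , m) ((d , m') ∷ P) with ≡-dec ℕP._≟_ (proj₁ m) (proj₁ m') ×-dec ≡-dec ℕP._≟_ (proj₂ m) (proj₂ m')
  ... | yes _ = (c ℤ.+ d , m') ∷ P
  ... | no  _ = (d , m') ∷ insertTerm (c , m) P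

  collect : ZPoly N → ZPoly N
  collect = List.foldr insertTerm []

  -- exact division of all coefficients by a natural number n
  -- (division by 0 is junk and never used)
  pdivℕ : ZPoly N → ℕ → ZPoly N
  pdivℕ P zero    = P
  pdivℕ P (suc n) = List.map (λ { (c , m) → (c /ℕ suc n , m) }) (collect P)

  unitVec : ℕ → Vec ℕ N
  unitVec j = Vec.tabulate (λ (i : Fin N) → if⇒ (toℕ i) j)
    where
    if⇒ : ℕ → ℕ → ℕ
    if⇒ i j with i ℕP.≟ j
    ... | yes _ = 1
    ... | no  _ = 0

  varX : ℕ → ZPoly N
  varX j = (+ 1 , (unitVec j , Vec.replicate N 0)) ∷ []

  varY : ℕ → ZPoly N
  varY j = (+ 1 , (Vec.replicate N 0 , unitVec j)) ∷ []

module Witt (p : ℕ) {N : ℕ} where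

  psum : ℕ → (ℕ → ZPoly N) → ZPoly N
  psum zero    f = pzero
  psum (suc n) f = padd (psum n f) (f n)

  wittTerm : ℕ → ℕ → ZPoly N → ZPoly N
  wittTerm k j Z = pscale (+ (p ℕ.^ j)) (ppow Z (p ℕ.^ (k ℕ.∸ j)))

  -- Ss k = the list [S_0, …, S_k]-valued function: Ss k j = S_j for j ≤ k
  -- S_k is defined by  w_k(S_0..S_k) = w_k(X) + w_k(Y),  i.e.
  -- p^k S_k = Σ_{j≤k} p^j (X_j^{p^{k-j}} + Y_j^{p^{k-j}}) − Σ_{j<k} p^j S_j^{p^{k-j}}.
  Ss : ℕ → (ℕ → ZPoly N)
  Ss k = go k
    where
    go : ℕ → ℕ → ZPoly N
    go zero j = padd (varX 0) (varY 0)
    go (suc k) j with j ℕP.≤? k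
    ... | yes _ = go k j
    ... | no  _ =
      pdivℕ
        (padd (psum (suc (suc k)) (λ i → padd (wittTerm (suc k) i (varX i)) (wittTerm (suc k) i (varY i))))
              (pneg (psum (suc k) (λ i → wittTerm (suc k) i (go k i)))))
        (p ℕ.^ suc k)

S : (p d : ℕ) → ZPoly (suc d)
S p d = Witt.Ss p {suc d} d d

record IsField {c ℓ} (F : CommutativeRing c ℓ) : Set (c ⊔ ℓ) where
  open CommutativeRing F
  field
    nontrivial : ¬ (1# ≈ 0#)
    inverse    : ∀ x → ¬ (x ≈ 0#) → Σ Carrier λ y → (x * y) ≈ 1#

module FieldOps {c ℓ} (F : CommutativeRing c ℓ) where
  open CommutativeRing F

  pow : Carrier → ℕ → Carrier
  pow x zero    = 1#
  pow x (suc n) = x * pow x n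

  natF : ℕ → Carrier
  natF zero    = 0#
  natF (suc n) = 1# + natF n

  intF : ℤ → Carrier
  intF (+ n)      = natF n
  intF -[1+ n ]   = - natF (suc n)

  HasChar : ℕ → Set ℓ
  HasChar p = natF p ≈ 0#

  record IsSubfield {k} (K : Carrier → Set k) : Set (c ⊔ ℓ ⊔ k) where
    field
      resp  : ∀ {x y} → x ≈ y → K x → K y
      has0  : K 0#
      has1  : K 1#
      +-cl  : ∀ {x y} → K x → K y → K (x + y)
      neg-cl : ∀ {x} → K x → K (- x)
      *-cl  : ∀ {x y} → K x → K y → K (x * y)
      inv-cl : ∀ {x y} → K x → (x * y) ≈ 1# → K y

  -- F is perfect of characteristic p: every element has a p-th root
  -- (given as a root-choosing function; roots are unique in char p)
  PerfectStr : ℕ → Set (c ⊔ ℓ)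
  PerfectStr p = ∀ x → Σ Carrier λ y → pow y p ≈ x

  PurelyInsep : ∀ {k} → ℕ → (Carrier → Set k) → Set (c ⊔ k)
  PurelyInsep p K = ∀ x → Σ ℕ λ n → K (pow x (p ℕ.^ n))

  -- Polynomials in two indeterminates u, v over F, as finite sums of
  -- terms  a · u^i v^j , and their coefficients.

  FPoly2 : Set c
  FPoly2 = List (Carrier × ℕ × ℕ)

  coeff : FPoly2 → ℕ → ℕ → Carrier
  coeff [] A B = 0#
  coeff ((a , i , j) ∷ P) A B with i ℕP.≟ A | j ℕP.≟ B
  ... | yes _ | yes _ = a + coeff P A B
  ... | _     | _     = coeff P A B

  InPoly2 : ∀ {k} → (Carrier → Set k) → FPoly2 → Set k
  InPoly2 K P = ∀ A B → K (coeff P A B)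

  evalSubst : ∀ {N} → (Fin N → Carrier) → (Fin N → Carrier) → (Fin N → ℕ)
            → ZPoly N → FPoly2
  evalSubst {N} xs ys e = List.map term
    where
    prodF : (Fin N → Carrier) → Vec ℕ N → Carrier
    prodF f a = Vec.foldr _ _*_ 1# (Vec.zipWith pow (Vec.tabulate f) a)
    deg : Vec ℕ N → ℕ
    deg a = Vec.foldr _ ℕ._+_ 0 (Vec.zipWith ℕ._*_ (Vec.tabulate e) a)
    term : ℤ × Mon N → Carrier × ℕ × ℕ
    term (c , (a , b)) = (intF c * (prodF xs a * prodF ys b)) , deg a , deg b

  -- The sequence g_i (given g and a p-th root structure):
  -- g_1 = g, g_i = g^{p^{1-i}} · g_{i-1}^{p^r}; we also set g_0 = 1
  -- (the coefficient of the last entry u).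
  module GSeq (p : ℕ) (perf : PerfectStr p) (r : ℕ) (g : Carrier) where
    root : Carrier → Carrier
    root x = proj₁ (perf x)

    rootN : ℕ → Carrier → Carrier
    rootN zero    x = x
    rootN (suc n) x = root (rootN n x)

    gs : ℕ → Carrier
    gs zero          = 1#
    gs (suc zero)    = g
    gs (suc (suc i)) = rootN (suc i) g * pow (gs (suc i)) (p ℕ.^ r)

    -- The entry at position j ∈ {0..d} of (g_d u^{p^{dr}}, …, g_1 u^{p^r}, u):
    -- coefficient g_{d-j}, exponent p^{(d-j) r}.
    coefAt : (d : ℕ) → Fin (suc d) → Carrier
    coefAt d j = gs (d ℕ.∸ toℕ j)

    expAt : (d : ℕ) → Fin (suc d) → ℕ
    expAt d j = p ℕ.^ ((d ℕ.∸ toℕ j) ℕ.* r)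

    Sd-uv : (d : ℕ) → FPoly2
    Sd-uv d = evalSubst (coefAt d) (coefAt d) (expAt d) (S p d)

{-# OPTIONS --safe #-}
module Submission where

-- With h = g^(p^-d), every g_i (i ≤ d) is a power h^(e_i), where e_0 = 0 and
-- e_(i+1) = p^(d-i) + p^r e_i. These exponents satisfy p e_(i+1) ≡ e_i (mod p^(d+1)),
-- hence p^j e_d ≡ e_(d-j), and moreover p ∣ e_d. The Witt addition polynomial S_d is
-- isobaric of weight p^d when X_j and Y_j have weight p^j, so a monomial
-- ∏ X_j^(a_j) Y_j^(b_j) of S_d acquires an integer multiple of h^E as coefficient, where
-- E = Σ_j e_(d-j) (a_j + b_j) ≡ e_d Σ_j p^j (a_j + b_j) = p^d e_d ≡ 0 (mod p^(d+1)).
-- So the coefficient lies in K, being a power of h^(p^(d+1)) = g^p. Only the p-th roots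
-- and g^p ∈ K enter.

open import Defs
open import Level using (Level)
open import Data.Nat using (ℕ; _≤_)
open import Data.Nat.Primality using (Prime)
open import Algebra.Bundles using (CommutativeRing)
open import Function using (_∘_)
import Data.Nat as ℕ
open import Data.Nat using (zero; suc; _∸_; _<_; z≤n; s≤s)
import Data.Nat.Properties as ℕP
open import Data.Nat.Divisibility
  using (_∣_; divides; _∣0; ∣m+n∣m⇒∣n; ∣m∣n⇒∣m+n; m∣m*n; *-monoʳ-∣; ∣-trans)
open import Data.Nat.Tactic.RingSolver using (solve-∀)
open import Data.Integer as ℤ using (ℤ; 0ℤ)
import Data.Integer.Properties as ℤP
import Data.Integer.DivMod as ℤDM
open import Data.Fin using (Fin; toℕ) renaming (zero to fzero; suc to fsuc)
open import Data.Fin.Properties using (toℕ<n)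
open import Data.Vec as Vec using (Vec; []; _∷_)
import Data.Vec.Properties as VecP
open import Data.List using ([]; _∷_)
open import Data.List.Relation.Unary.All as All using (All; []; _∷_)
import Data.List.Relation.Unary.All.Properties as AllP
open import Data.Product using (_×_; _,_; proj₁; proj₂)
open import Data.Sum using (_⊎_; inj₁; inj₂)
open import Data.Empty using (⊥-elim)
open import Relation.Nullary using (¬_; yes; no)
open import Relation.Nullary.Decidable using (_×-dec_)
import Relation.Binary.PropositionalEquality as ≡

module WittIsobaric where

  open import Data.Nat using (_+_; _*_; _^_)
  open import Relation.Binary.PropositionalEquality

  weightedSum : ∀ {n} → (ℕ → ℕ) → Vec ℕ n → ℕ
  weightedSum w []      = 0
  weightedSum w (x ∷ a) = w 0 * x + weightedSum (w ∘ suc) a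

  weightedSum-zipWith-+ : ∀ {n} w (a b : Vec ℕ n) →
    weightedSum w (Vec.zipWith _+_ a b) ≡ weightedSum w a + weightedSum w b
  weightedSum-zipWith-+ w []      []      = refl
  weightedSum-zipWith-+ w (x ∷ a) (y ∷ b) = begin
    w 0 * (x + y) + weightedSum (w ∘ suc) (Vec.zipWith _+_ a b)
      ≡⟨ cong ((w 0 * (x + y)) +_) (weightedSum-zipWith-+ (w ∘ suc) a b) ⟩
    w 0 * (x + y) + (A + B)
      ≡⟨ interchange (w 0) x y A B ⟩
    (w 0 * x + A) + (w 0 * y + B) ∎
    where
    open ≡-Reasoning
    A = weightedSum (w ∘ suc) a
    B = weightedSum (w ∘ suc) b
    interchange : ∀ c x y A B → c * (x + y) + (A + B) ≡ (c * x + A) + (c * y + B)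
    interchange = solve-∀

  weightedSum-zeros : ∀ {n} w (a : Vec ℕ n) → (∀ i → Vec.lookup a i ≡ 0) → weightedSum w a ≡ 0
  weightedSum-zeros w []      _     = refl
  weightedSum-zeros w (x ∷ a) a≡0 rewrite a≡0 fzero | ℕP.*-zeroʳ (w 0) =
    weightedSum-zeros (w ∘ suc) a (a≡0 ∘ fsuc)

  weightedSum-indicator : ∀ {n} w j (f : Fin n → ℕ) → j < n →
    (∀ i → toℕ i ≡ j → f i ≡ 1) → (∀ i → ¬ toℕ i ≡ j → f i ≡ 0) →
    weightedSum w (Vec.tabulate f) ≡ w j
  weightedSum-indicator w zero f (s≤s _) f≡1 f≡0
    rewrite f≡1 fzero refl
          | weightedSum-zeros (w ∘ suc) (Vec.tabulate (f ∘ fsuc))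
              (λ i → trans (VecP.lookup∘tabulate (f ∘ fsuc) i) (f≡0 (fsuc i) λ ()))
    = trans (ℕP.+-identityʳ _) (ℕP.*-identityʳ _)
  weightedSum-indicator w (suc j) f (s≤s j<n) f≡1 f≡0
    rewrite f≡0 fzero (λ ()) | ℕP.*-zeroʳ (w 0) =
    weightedSum-indicator (w ∘ suc) j (f ∘ fsuc) j<n
      (λ i → f≡1 (fsuc i) ∘ cong suc) (λ i i≢j → f≡0 (fsuc i) (i≢j ∘ ℕP.suc-injective))

  -- The entries of unitVec come from a function local to Defs that cannot be named here,
  -- so the types of unitVec-on and unitVec-off are inferred from their use.
  mutual
    weightedSum-unitVec : ∀ {N} w j → j < N → weightedSum w (unitVec {N} j) ≡ w j
    weightedSum-unitVec w j j<N = weightedSum-indicator w j _ j<N (unitVec-on j) (unitVec-off j)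

    private
      unitVec-on : ∀ {N} j (i : Fin N) → toℕ i ≡ j → _
      unitVec-on j i i≡j with toℕ i ℕP.≟ j
      ... | yes _   = refl
      ... | no i≢j = ⊥-elim (i≢j i≡j)

      unitVec-off : ∀ {N} j (i : Fin N) → ¬ toℕ i ≡ j → _
      unitVec-off j i i≢j with toℕ i ℕP.≟ j
      ... | yes i≡j = ⊥-elim (i≢j i≡j)
      ... | no _    = refl

  weightedSum-replicate-0 : ∀ {n} w → weightedSum w (Vec.replicate n 0) ≡ 0
  weightedSum-replicate-0 {n} w = weightedSum-zeros w (Vec.replicate n 0) (λ i → VecP.lookup-replicate i 0)

  module Isobaric (p : ℕ) where

    weight : ∀ {N} → Mon N → ℕ
    weight (a , b) = weightedSum (p ^_) a + weightedSum (p ^_) b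

    IsobaricTerm : ∀ {N} → ℕ → ℤ × Mon N → Set
    IsobaricTerm W (c , m) = c ≡ 0ℤ ⊎ weight m ≡ W

    Isobaric : ∀ {N} → ℕ → ZPoly N → Set
    Isobaric W = All (IsobaricTerm W)

    weight-monMul : ∀ {N} (m m' : Mon N) → weight (monMul m m') ≡ weight m + weight m'
    weight-monMul (a , b) (a' , b') = begin
      weightedSum (p ^_) (Vec.zipWith _+_ a a') + weightedSum (p ^_) (Vec.zipWith _+_ b b')
        ≡⟨ cong₂ _+_ (weightedSum-zipWith-+ (p ^_) a a') (weightedSum-zipWith-+ (p ^_) b b') ⟩
      (A + A') + (B + B')
        ≡⟨ interchange A A' B B' ⟩
      (A + B) + (A' + B') ∎
      where
      open ≡-Reasoning
      A = weightedSum (p ^_) a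
      A' = weightedSum (p ^_) a'
      B = weightedSum (p ^_) b
      B' = weightedSum (p ^_) b'
      interchange : ∀ A A' B B' → (A + A') + (B + B') ≡ (A + B) + (A' + B')
      interchange = solve-∀

    module _ {N : ℕ} where

      isobaric-padd : ∀ {W} {P Q : ZPoly N} → Isobaric W P → Isobaric W Q → Isobaric W (padd P Q)
      isobaric-padd = AllP.++⁺

      isobaricTerm-scale : ∀ {W} c {t : ℤ × Mon N} →
                           IsobaricTerm W t → IsobaricTerm W (c ℤ.* proj₁ t , proj₂ t)
      isobaricTerm-scale c (inj₁ d≡0) = inj₁ (trans (cong (c ℤ.*_) d≡0) (ℤP.*-zeroʳ c))
      isobaricTerm-scale c (inj₂ w)   = inj₂ w

      isobaric-pscale : ∀ {W} c {P : ZPoly N} → Isobaric W P → Isobaric W (pscale c P)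
      isobaric-pscale c = AllP.map⁺ ∘ All.map (λ {t} → isobaricTerm-scale c {t})

      isobaricTerm-* : ∀ {W W'} {t : ℤ × Mon N} → IsobaricTerm W t → ∀ {t'} → IsobaricTerm W' t' →
                       IsobaricTerm (W + W') (proj₁ t ℤ.* proj₁ t' , monMul (proj₂ t) (proj₂ t'))
      isobaricTerm-* (inj₁ c≡0) {d , _} _ = inj₁ (trans (cong (ℤ._* d) c≡0) (ℤP.*-zeroˡ d))
      isobaricTerm-* {t = c , _} (inj₂ _) (inj₁ d≡0) = inj₁ (trans (cong (c ℤ.*_) d≡0) (ℤP.*-zeroʳ c))
      isobaricTerm-* {t = _ , m} (inj₂ w) {_ , m'} (inj₂ w') =
        inj₂ (trans (weight-monMul m m') (cong₂ _+_ w w'))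

      isobaric-pmul : ∀ {W W'} {P Q : ZPoly N} → Isobaric W P → Isobaric W' Q → Isobaric (W + W') (pmul P Q)
      isobaric-pmul []            isoQ = []
      isobaric-pmul {P = t ∷ _} (isoT ∷ isoP) isoQ =
        AllP.++⁺ (AllP.map⁺ (All.map (λ {t'} → isobaricTerm-* {t = t} isoT {t'}) isoQ))
                 (isobaric-pmul isoP isoQ)

      isobaric-pconst-1 : Isobaric 0 (pconst {N} (ℤ.+ 1))
      isobaric-pconst-1 =
        inj₂ (cong₂ _+_ (weightedSum-replicate-0 {N} (p ^_)) (weightedSum-replicate-0 {N} (p ^_))) ∷ []

      isobaric-ppow : ∀ {W} {P : ZPoly N} n → Isobaric W P → Isobaric (n * W) (ppow P n)
      isobaric-ppow zero    isoP = isobaric-pconst-1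
      isobaric-ppow (suc n) isoP = isobaric-pmul isoP (isobaric-ppow n isoP)

      isobaric-insertTerm : ∀ {W} (t : ℤ × Mon N) P →
                            IsobaricTerm W t → Isobaric W P → Isobaric W (insertTerm t P)
      isobaric-insertTerm t [] isoT [] = isoT ∷ []
      isobaric-insertTerm (c , m) ((d , m') ∷ P) isoT (isoD ∷ isoP)
        with VecP.≡-dec ℕP._≟_ (proj₁ m) (proj₁ m') ×-dec VecP.≡-dec ℕP._≟_ (proj₂ m) (proj₂ m')
      ... | no _  = isoD ∷ isobaric-insertTerm (c , m) P isoT isoP
      ... | yes (refl , refl) with isoT
      ...   | inj₂ w    = inj₂ w ∷ isoP
      ...   | inj₁ refl = subst (λ e → IsobaricTerm _ (e , m')) (sym (ℤP.+-identityˡ d)) isoD ∷ isoP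

      isobaric-collect : ∀ {W} (P : ZPoly N) → Isobaric W P → Isobaric W (collect P)
      isobaric-collect []      []           = []
      isobaric-collect (t ∷ P) (isoT ∷ isoP) = isobaric-insertTerm t (collect P) isoT (isobaric-collect P isoP)

      isobaric-pdivℕ : ∀ {W} (P : ZPoly N) n → Isobaric W P → Isobaric W (pdivℕ P n)
      isobaric-pdivℕ     P zero    isoP = isoP
      isobaric-pdivℕ {W} P (suc n) isoP =
        AllP.map⁺ (All.map (λ {t} → isobaricTerm-div {t}) (isobaric-collect P isoP))
        where
        isobaricTerm-div : ∀ {t : ℤ × Mon N} →
                           IsobaricTerm W t → IsobaricTerm W (proj₁ t ℤDM./ℕ suc n , proj₂ t)
        isobaricTerm-div (inj₁ refl) = inj₁ refl
        isobaricTerm-div (inj₂ w)    = inj₂ w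

      isobaric-varX : ∀ j → j < N → Isobaric (p ^ j) (varX {N} j)
      isobaric-varX j j<N =
        inj₂ (trans (cong₂ _+_ (weightedSum-unitVec (p ^_) j j<N) (weightedSum-replicate-0 {N} (p ^_)))
                    (ℕP.+-identityʳ _)) ∷ []

      isobaric-varY : ∀ j → j < N → Isobaric (p ^ j) (varY {N} j)
      isobaric-varY j j<N =
        inj₂ (cong₂ _+_ (weightedSum-replicate-0 {N} (p ^_)) (weightedSum-unitVec (p ^_) j j<N)) ∷ []

      open Witt p {N}

      isobaric-psum : ∀ {W} n (f : ℕ → ZPoly N) →
                      (∀ i → i < n → Isobaric W (f i)) → Isobaric W (psum n f)
      isobaric-psum zero    f isoF = []
      isobaric-psum (suc n) f isoF =
        isobaric-padd (isobaric-psum n f (λ i i<n → isoF i (ℕP.m<n⇒m<1+n i<n))) (isoF n ℕP.≤-refl)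

      isobaric-wittTerm : ∀ {k j} {Z : ZPoly N} →
                          j ≤ k → Isobaric (p ^ j) Z → Isobaric (p ^ k) (wittTerm k j Z)
      isobaric-wittTerm {k} {j} {Z} j≤k isoZ =
        isobaric-pscale (ℤ.+ (p ^ j)) (subst (λ W → Isobaric W (ppow Z (p ^ (k ∸ j)))) p^[k∸j]*p^j≡p^k
          (isobaric-ppow (p ^ (k ∸ j)) isoZ))
        where
        p^[k∸j]*p^j≡p^k : p ^ (k ∸ j) * p ^ j ≡ p ^ k
        p^[k∸j]*p^j≡p^k = trans (sym (ℕP.^-distribˡ-+-* p (k ∸ j) j)) (cong (p ^_) (ℕP.m∸n+n≡m j≤k))

      isobaric-Ss : ∀ k j → k < N → j ≤ k → Isobaric (p ^ j) (Ss k j)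
      isobaric-Ss zero    zero k<N _ = isobaric-padd (isobaric-varX 0 k<N) (isobaric-varY 0 k<N)
      isobaric-Ss (suc k) j k+1<N j≤k+1 with j ℕP.≤? k
      ... | yes j≤k = isobaric-Ss k j k<N j≤k
        where k<N = ℕP.<-trans (ℕP.n<1+n k) k+1<N
      ... | no  j≰k rewrite ℕP.≤-antisym j≤k+1 (ℕP.≰⇒> j≰k) =
        isobaric-pdivℕ _ (p ^ suc k)
          (isobaric-padd isobaric-wittSum-XY (isobaric-pscale (ℤ.- ℤ.+ 1) isobaric-wittSum-S))
        where
        isobaric-wittSum-XY : Isobaric (p ^ suc k)
          (psum (suc (suc k)) λ i → padd (wittTerm (suc k) i (varX i)) (wittTerm (suc k) i (varY i)))
        isobaric-wittSum-XY = isobaric-psum (suc (suc k)) _ λ i i<k+2 →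
          isobaric-padd (isobaric-wittTerm (ℕP.≤-pred i<k+2) (isobaric-varX i (ℕP.≤-trans i<k+2 k+1<N)))
                        (isobaric-wittTerm (ℕP.≤-pred i<k+2) (isobaric-varY i (ℕP.≤-trans i<k+2 k+1<N)))
        isobaric-wittSum-S : Isobaric (p ^ suc k) (psum (suc k) λ i → wittTerm (suc k) i (Ss k i))
        isobaric-wittSum-S = isobaric-psum (suc k) _ λ i i<k+1 →
          isobaric-wittTerm (ℕP.<⇒≤ i<k+1)
            (isobaric-Ss k i (ℕP.<-trans (ℕP.n<1+n k) k+1<N) (ℕP.≤-pred i<k+1))

  isobaric-S : ∀ p d → Isobaric.Isobaric p (p ^ d) (S p d)
  isobaric-S p d = Isobaric.isobaric-Ss p d d ℕP.≤-refl ℕP.≤-refl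

module ExponentCongruence where

  open import Data.Nat using (_+_; _*_; _^_)
  open import Relation.Binary.PropositionalEquality
  open WittIsobaric using (weightedSum)

  infix 4 _≡_[mod_]

  -- One-sided congruence: m exceeds n by a multiple of M, which avoids truncated subtraction.
  record _≡_[mod_] (m n M : ℕ) : Set where
    constructor congruent
    field
      quotient : ℕ
      equality : m ≡ n + M * quotient

  module _ {M : ℕ} where

    ≡⇒≡-mod : ∀ {m n} → m ≡ n → m ≡ n [mod M ]
    ≡⇒≡-mod {n = n} refl = congruent 0 (sym (trans (cong (n +_) (ℕP.*-zeroʳ M)) (ℕP.+-identityʳ n)))

    ≡-mod-trans : ∀ {m n o} → m ≡ n [mod M ] → n ≡ o [mod M ] → m ≡ o [mod M ]
    ≡-mod-trans {o = o} (congruent D refl) (congruent E refl) = congruent (E + D) (regroup o M E D)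
      where
      regroup : ∀ o M E D → (o + M * E) + M * D ≡ o + M * (E + D)
      regroup = solve-∀

    ≡-mod-+ : ∀ {m n m' n'} → m ≡ n [mod M ] → m' ≡ n' [mod M ] → m + m' ≡ n + n' [mod M ]
    ≡-mod-+ {n = n} {n' = n'} (congruent D refl) (congruent D' refl) = congruent (D + D') (regroup n n' M D D')
      where
      regroup : ∀ n n' M D D' → (n + M * D) + (n' + M * D') ≡ (n + n') + M * (D + D')
      regroup = solve-∀

    ≡-mod-*ʳ : ∀ k {m n} → m ≡ n [mod M ] → m * k ≡ n * k [mod M ]
    ≡-mod-*ʳ k {n = n} (congruent D refl) = congruent (D * k) (regroup n M D k)
      where
      regroup : ∀ n M D k → (n + M * D) * k ≡ n * k + M * (D * k)
      regroup = solve-∀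

    ≡-mod-*ˡ : ∀ k {m n} → m ≡ n [mod M ] → k * m ≡ k * n [mod M ]
    ≡-mod-*ˡ k {m} {n} m≡n =
      subst₂ (λ a b → a ≡ b [mod M ]) (ℕP.*-comm m k) (ℕP.*-comm n k) (≡-mod-*ʳ k m≡n)

    ∣-≡-mod : ∀ {m n} → M ∣ m → m ≡ n [mod M ] → M ∣ n
    ∣-≡-mod {n = n} M∣m (congruent D refl) =
      ∣m+n∣m⇒∣n (subst (M ∣_) (ℕP.+-comm n (M * D)) M∣m) (m∣m*n D)

    weightedSum-≡-mod : ∀ {n} k (w w' : ℕ → ℕ) (a : Vec ℕ n) →
      (∀ (i : Fin n) → w (toℕ i) * k ≡ w' (toℕ i) [mod M ]) →
      weightedSum w a * k ≡ weightedSum w' a [mod M ]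
    weightedSum-≡-mod k w w' []      _   = ≡⇒≡-mod refl
    weightedSum-≡-mod k w w' (x ∷ a) w≡w' =
      ≡-mod-trans (≡⇒≡-mod (distrib (w 0) x (weightedSum (w ∘ suc) a) k))
        (≡-mod-+ (≡-mod-*ʳ x (w≡w' fzero)) (weightedSum-≡-mod k (w ∘ suc) (w' ∘ suc) a (w≡w' ∘ fsuc)))
      where
      distrib : ∀ c x S k → (c * x + S) * k ≡ c * k * x + S * k
      distrib = solve-∀

  module Exponents (p d r : ℕ) where

    exponent : ℕ → ℕ
    exponent zero    = 0
    exponent (suc i) = p ^ (d ∸ i) + exponent i * p ^ r

    p*exponent-suc : ∀ i → i < d → p * exponent (suc i) ≡ exponent i [mod p ^ suc d ]
    p*exponent-suc zero    _ =
      congruent 1 (trans (cong (p *_) (ℕP.+-identityʳ (p ^ d))) (sym (ℕP.*-identityʳ (p ^ suc d))))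
    p*exponent-suc (suc i) i+1<d =
      ≡-mod-trans (≡⇒≡-mod (trans (ℕP.*-distribˡ-+ p _ _) (cong₂ _+_ p*p^[d∸i+1] (sym (ℕP.*-assoc p _ _)))))
        (≡-mod-+ (≡⇒≡-mod refl) (≡-mod-*ʳ (p ^ r) (p*exponent-suc i (ℕP.<-trans (ℕP.n<1+n i) i+1<d))))
      where
      p*p^[d∸i+1] : p * p ^ (d ∸ suc i) ≡ p ^ (d ∸ i)
      p*p^[d∸i+1] = cong (p ^_) (sym (ℕP.+-∸-assoc 1 (ℕP.<⇒≤ i+1<d)))

    p^j*exponent : ∀ j → j ≤ d → p ^ j * exponent d ≡ exponent (d ∸ j) [mod p ^ suc d ]
    p^j*exponent zero    _   = ≡⇒≡-mod (ℕP.*-identityˡ _)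
    p^j*exponent (suc j) j<d =
      ≡-mod-trans (≡⇒≡-mod (ℕP.*-assoc p (p ^ j) (exponent d)))
        (≡-mod-trans (≡-mod-*ˡ p (p^j*exponent j (ℕP.<⇒≤ j<d)))
          (subst (λ e → p * exponent e ≡ exponent (d ∸ suc j) [mod p ^ suc d ])
                 (sym (ℕP.+-∸-assoc 1 j<d)) (p*exponent-suc (d ∸ suc j) (ℕP.∸-monoʳ-< (s≤s z≤n) j<d))))

    p∣exponent : ∀ i → i ≤ d → p ∣ exponent i
    p∣exponent zero    _   = p ∣0
    p∣exponent (suc i) i<d =
      ∣m∣n⇒∣m+n (subst (p ∣_) (cong (p ^_) (sym (ℕP.+-∸-assoc 1 i<d))) (m∣m*n (p ^ (d ∸ suc i))))
                (∣-trans (p∣exponent i (ℕP.<⇒≤ i<d)) (m∣m*n (p ^ r)))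

    p^[d+1]∣weightedSum-exponent : (a b : Vec ℕ (suc d)) →
      weightedSum (p ^_) a + weightedSum (p ^_) b ≡ p ^ d →
      p ^ suc d ∣ weightedSum (exponent ∘ (d ∸_)) a + weightedSum (exponent ∘ (d ∸_)) b
    p^[d+1]∣weightedSum-exponent a b weight≡p^d =
      ∣-≡-mod (subst (λ W → p ^ suc d ∣ W * exponent d) (sym weight≡p^d) p^[d+1]∣p^d*exponent)
        (≡-mod-trans (≡⇒≡-mod (ℕP.*-distribʳ-+ (exponent d) (weightedSum (p ^_) a) (weightedSum (p ^_) b)))
          (≡-mod-+ (weightedSum-≡-mod _ _ _ a p^i*exponent) (weightedSum-≡-mod _ _ _ b p^i*exponent)))
      where
      p^i*exponent : ∀ (i : Fin (suc d)) → p ^ toℕ i * exponent d ≡ exponent (d ∸ toℕ i) [mod p ^ suc d ]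
      p^i*exponent i = p^j*exponent (toℕ i) (ℕP.≤-pred (toℕ<n i))
      p^[d+1]∣p^d*exponent : p ^ suc d ∣ p ^ d * exponent d
      p^[d+1]∣p^d*exponent =
        subst (_∣ p ^ d * exponent d) (ℕP.*-comm (p ^ d) p) (*-monoʳ-∣ (p ^ d) (p∣exponent d ℕP.≤-refl))

open WittIsobaric using (weightedSum; module Isobaric; isobaric-S)
open ExponentCongruence using (module Exponents)

module PowerLaws {c ℓ} (R : CommutativeRing c ℓ) where
  open CommutativeRing R
  open FieldOps R
  open import Algebra.Properties.Semiring.Exp semiring using (_^_; ^-congˡ; ^-homo-*; ^-assocʳ)
  open import Relation.Binary.Reasoning.Setoid setoid

  pow≡^ : ∀ x n → pow x n ≡.≡ x ^ n
  pow≡^ x zero    = ≡.refl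
  pow≡^ x (suc n) = ≡.cong (x *_) (pow≡^ x n)

  pow-congˡ : ∀ {x y} n → x ≈ y → pow x n ≈ pow y n
  pow-congˡ {x} {y} n x≈y rewrite pow≡^ x n | pow≡^ y n = ^-congˡ n x≈y

  pow-homo-* : ∀ x m n → pow x (m ℕ.+ n) ≈ pow x m * pow x n
  pow-homo-* x m n rewrite pow≡^ x (m ℕ.+ n) | pow≡^ x m | pow≡^ x n = ^-homo-* x m n

  pow-assocʳ : ∀ x m n → pow (pow x m) n ≈ pow x (m ℕ.* n)
  pow-assocʳ x m n rewrite pow≡^ (pow x m) n | pow≡^ x m | pow≡^ x (m ℕ.* n) = ^-assocʳ x m n

  productPow : ∀ {n} → (Fin n → Carrier) → Vec ℕ n → Carrier
  productPow f a = Vec.foldr (λ _ → Carrier) _*_ 1# (Vec.zipWith pow (Vec.tabulate f) a)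

  productPow-powers : ∀ {n} h (w : ℕ → ℕ) (f : Fin n → Carrier) (a : Vec ℕ n) →
    (∀ i → f i ≈ pow h (w (toℕ i))) → productPow f a ≈ pow h (weightedSum w a)
  productPow-powers h w f []      _      = refl
  productPow-powers h w f (x ∷ a) f≈h^w = begin
    pow (f fzero) x * productPow (f ∘ fsuc) a
      ≈⟨ *-cong (pow-congˡ x (f≈h^w fzero)) (productPow-powers h (w ∘ suc) (f ∘ fsuc) a (f≈h^w ∘ fsuc)) ⟩
    pow (pow h (w 0)) x * pow h (weightedSum (w ∘ suc) a)
      ≈⟨ *-congʳ (pow-assocʳ h (w 0) x) ⟩
    pow h (w 0 ℕ.* x) * pow h (weightedSum (w ∘ suc) a)
      ≈⟨ pow-homo-* h (w 0 ℕ.* x) _ ⟨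
    pow h (weightedSum w (x ∷ a)) ∎

module SubfieldClosure {c ℓ k} (R : CommutativeRing c ℓ) {K : CommutativeRing.Carrier R → Set k}
                       (sub : FieldOps.IsSubfield R K) where
  open CommutativeRing R
  open FieldOps R
  open IsSubfield sub

  natF-closed : ∀ n → K (natF n)
  natF-closed zero    = has0
  natF-closed (suc n) = +-cl has1 (natF-closed n)

  intF-closed : ∀ z → K (intF z)
  intF-closed (ℤ.+ n)    = natF-closed n
  intF-closed ℤ.-[1+ n ] = neg-cl (natF-closed (suc n))

  pow-closed : ∀ {x} n → K x → K (pow x n)
  pow-closed zero    _  = has1
  pow-closed (suc n) Kx = *-cl Kx (pow-closed n Kx)

  coeff-closed : ∀ (P : FPoly2) → All (K ∘ proj₁) P → InPoly2 K P
  coeff-closed []                _          A B = has0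
  coeff-closed ((a , i , j) ∷ P) (Ka ∷ KP) A B with i ℕP.≟ A | j ℕP.≟ B
  ... | yes _ | yes _ = +-cl Ka (coeff-closed P KP A B)
  ... | yes _ | no  _ = coeff-closed P KP A B
  ... | no  _ | _     = coeff-closed P KP A B

module RootSequence {c ℓ} (R : CommutativeRing c ℓ) (p : ℕ) (perf : FieldOps.PerfectStr R p)
                    (r : ℕ) (g : CommutativeRing.Carrier R) where
  open CommutativeRing R
  open FieldOps R
  open GSeq p perf r g
  open PowerLaws R
  open import Relation.Binary.Reasoning.Setoid setoid

  rootN-pow : ∀ n x → pow (rootN n x) (p ℕ.^ n) ≈ x
  rootN-pow zero    x = *-identityʳ x
  rootN-pow (suc n) x = begin
    pow (root y) (p ℕ.* p ℕ.^ n)   ≈⟨ pow-assocʳ (root y) p (p ℕ.^ n) ⟨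
    pow (pow (root y) p) (p ℕ.^ n) ≈⟨ pow-congˡ (p ℕ.^ n) (proj₂ (perf y)) ⟩
    pow y (p ℕ.^ n)                ≈⟨ rootN-pow n x ⟩
    x                              ∎
    where y = rootN n x

  rootN-+ : ∀ m n x → rootN (m ℕ.+ n) x ≡.≡ rootN m (rootN n x)
  rootN-+ zero    n x = ≡.refl
  rootN-+ (suc m) n x = ≡.cong root (rootN-+ m n x)

  module _ (d : ℕ) where
    open Exponents p d r

    h : Carrier
    h = rootN d g

    rootN≈pow-h : ∀ m → m ≤ d → rootN m g ≈ pow h (p ℕ.^ (d ∸ m))
    rootN≈pow-h m m≤d = begin
      rootN m g                                       ≈⟨ rootN-pow (d ∸ m) (rootN m g) ⟨
      pow (rootN (d ∸ m) (rootN m g)) (p ℕ.^ (d ∸ m)) ≡⟨ ≡.cong (λ y → pow y (p ℕ.^ (d ∸ m))) rootN-rootN≡h ⟩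
      pow h (p ℕ.^ (d ∸ m))                           ∎
      where
      rootN-rootN≡h : rootN (d ∸ m) (rootN m g) ≡.≡ h
      rootN-rootN≡h = ≡.trans (≡.sym (rootN-+ (d ∸ m) m g)) (≡.cong (λ n → rootN n g) (ℕP.m∸n+n≡m m≤d))

    gs≈pow-h : ∀ i → i ≤ d → gs i ≈ pow h (exponent i)
    gs≈pow-h zero          _     = refl
    gs≈pow-h (suc zero)    _     = begin
      g                  ≈⟨ rootN≈pow-h 0 z≤n ⟩
      pow h (p ℕ.^ d)    ≡⟨ ≡.cong (pow h) (ℕP.+-identityʳ (p ℕ.^ d)) ⟨
      pow h (exponent 1) ∎
    gs≈pow-h (suc (suc i)) i+2≤d = begin
      rootN (suc i) g * pow (gs (suc i)) (p ℕ.^ r)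
        ≈⟨ *-cong (rootN≈pow-h (suc i) i+1≤d) (pow-congˡ (p ℕ.^ r) (gs≈pow-h (suc i) i+1≤d)) ⟩
      pow h (p ℕ.^ (d ∸ suc i)) * pow (pow h (exponent (suc i))) (p ℕ.^ r)
        ≈⟨ *-congˡ (pow-assocʳ h (exponent (suc i)) (p ℕ.^ r)) ⟩
      pow h (p ℕ.^ (d ∸ suc i)) * pow h (exponent (suc i) ℕ.* p ℕ.^ r)
        ≈⟨ pow-homo-* h (p ℕ.^ (d ∸ suc i)) (exponent (suc i) ℕ.* p ℕ.^ r) ⟨
      pow h (exponent (suc (suc i))) ∎
      where i+1≤d = ℕP.<⇒≤ i+2≤d

    coefAt≈pow-h : ∀ i → coefAt d i ≈ pow h (exponent (d ∸ toℕ i))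
    coefAt≈pow-h i = gs≈pow-h (d ∸ toℕ i) (ℕP.m∸n≤m d (toℕ i))

    h^[p^[d+1]]≈g^p : pow h (p ℕ.^ suc d) ≈ pow g p
    h^[p^[d+1]]≈g^p = begin
      pow h (p ℕ.* p ℕ.^ d)   ≡⟨ ≡.cong (pow h) (ℕP.*-comm p (p ℕ.^ d)) ⟩
      pow h (p ℕ.^ d ℕ.* p)   ≈⟨ pow-assocʳ h (p ℕ.^ d) p ⟨
      pow (pow h (p ℕ.^ d)) p ≈⟨ pow-congˡ p (rootN-pow d g) ⟩
      pow g p                 ∎

    module _ {k} {K : Carrier → Set k} (sub : IsSubfield K) (Kg^p : K (pow g p)) where
      open IsSubfield sub
      open SubfieldClosure R sub
      open Isobaric p using (IsobaricTerm)

      pow-h-closed : ∀ {n} → p ℕ.^ suc d ∣ n → K (pow h n)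
      pow-h-closed (divides q ≡.refl) = resp (sym h^n≈[g^p]^q) (pow-closed q Kg^p)
        where
        h^n≈[g^p]^q : pow h (q ℕ.* p ℕ.^ suc d) ≈ pow (pow g p) q
        h^n≈[g^p]^q = begin
          pow h (q ℕ.* p ℕ.^ suc d)   ≡⟨ ≡.cong (pow h) (ℕP.*-comm q (p ℕ.^ suc d)) ⟩
          pow h (p ℕ.^ suc d ℕ.* q)   ≈⟨ pow-assocʳ h (p ℕ.^ suc d) q ⟨
          pow (pow h (p ℕ.^ suc d)) q ≈⟨ pow-congˡ q h^[p^[d+1]]≈g^p ⟩
          pow (pow g p) q             ∎

      substitutedTerm-closed : ∀ {t : ℤ × Mon (suc d)} → IsobaricTerm (p ℕ.^ d) t →
        K (intF (proj₁ t) * (productPow (coefAt d) (proj₁ (proj₂ t)) * productPow (coefAt d) (proj₂ (proj₂ t))))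
      substitutedTerm-closed               (inj₁ ≡.refl)     = resp (sym (zeroˡ _)) has0
      substitutedTerm-closed {c , (a , b)} (inj₂ weight≡p^d) =
        *-cl (intF-closed c)
             (resp (sym product≈h^E) (pow-h-closed (p^[d+1]∣weightedSum-exponent a b weight≡p^d)))
        where
        E : Vec ℕ (suc d) → ℕ
        E = weightedSum (exponent ∘ (d ∸_))
        product≈h^E : productPow (coefAt d) a * productPow (coefAt d) b ≈ pow h (E a ℕ.+ E b)
        product≈h^E = begin
          productPow (coefAt d) a * productPow (coefAt d) b
            ≈⟨ *-cong (productPow-powers h _ (coefAt d) a coefAt≈pow-h)
                      (productPow-powers h _ (coefAt d) b coefAt≈pow-h) ⟩
          pow h (E a) * pow h (E b) ≈⟨ pow-homo-* h (E a) (E b) ⟨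
          pow h (E a ℕ.+ E b)       ∎

lemma2p1 : ∀ {c ℓ k : Level} (L : CommutativeRing c ℓ) → IsField L →
    (p : ℕ) → Prime p → FieldOps.HasChar L p →
    (K : CommutativeRing.Carrier L → Set k) → FieldOps.IsSubfield L K →
    (perf : FieldOps.PerfectStr L p) → FieldOps.PurelyInsep L p K →
    (r : ℕ) → 1 ≤ r →
    (g : CommutativeRing.Carrier L) → K (FieldOps.pow L g p) →
    (d : ℕ) → FieldOps.InPoly2 L K (FieldOps.GSeq.Sd-uv L p perf r g d)
lemma2p1 L _ p _ _ K sub perf _ r _ g Kg^p d =
  coeff-closed (Sd-uv d) (AllP.map⁺ (All.map (λ {t} → substitutedTerm-closed d sub Kg^p {t}) (isobaric-S p d)))
  where
  open FieldOps L
  open GSeq p perf r g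
  open SubfieldClosure L sub using (coeff-closed)
  open RootSequence L p perf r g using (substitutedTerm-closed)
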